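{- Let $k\geq 6$ and $c\geq 1$ be integers and let $L_1,L_2$ be linear forests such that: $V(L_1)\cap V(L_2)=\{x\}$; $|V(L_1)|,|V(L_2)|>1$; $d_{L_1}(x)+d_{L_2}(x)=2$; $L_1$ and $L_2-\{x\}$ both have exactly $c$ components; and $|V(L_1)\cup V(L_2)|=2k$. Then there exists a set $E'$ of edges between $V(L_1)\setminus\{x\}$ and $V(L_2)\setminus\{x\}$ such that the graph $(V(L_1)\cup V(L_2),E'\cup E(L_1)\cup E(L_2))$ is isomorphic to the cycle $C_{2k}$.
   Context: A linear forest is a forest all of whose components are paths or isolated vertices. $d_L(x)$ denotes the degree of $x$ in $L$. -}

module Defs where

open import Data.Nat using (ℕ; zero; suc; _+_; _*_; _≤_; _<_; _≡ᵇ_)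
open import Data.Nat.Properties using (_≟_)
open import Data.Bool using (Bool; true; false; _∧_; _∨_; not; if_then_else_)
open import Data.Bool.ListAction using (any)
open import Data.List using (List; []; _∷_; length; filterᵇ; sum; map; _++_; deduplicate)
open import Data.List.Membership.Propositional using (_∈_)
open import Data.List.Relation.Unary.Unique.Propositional using (Unique)
open import Data.Fin using (Fin)
open import Data.Product using (Σ; ∃; _×_; _,_)
open import Data.Sum using (_⊎_)
open import Relation.Binary.PropositionalEquality using (_≡_; _≢_)

-- Vertex set: a duplicate-free list; edge set: a list of pairs, read as unordered
-- edges (so (u,w) and (w,u) denote the same edge), endpoints in V, no loops.
record Graph : Set where
  field
    V       : List ℕ
    E       : List (ℕ × ℕ)
    uniqueV : Unique V
    edgesIn : ∀ {u w} → (u , w) ∈ E → (u ∈ V) × (w ∈ V)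
    noLoop  : ∀ {u w} → (u , w) ∈ E → u ≢ w
open Graph public

adjB : List (ℕ × ℕ) → ℕ → ℕ → Bool
adjB E u w = any (λ { (a , b) → ((a ≡ᵇ u) ∧ (b ≡ᵇ w)) ∨ ((a ≡ᵇ w) ∧ (b ≡ᵇ u)) }) E

Adj : List (ℕ × ℕ) → ℕ → ℕ → Set
Adj E u w = adjB E u w ≡ true

degree : Graph → ℕ → ℕ
degree G x = length (filterᵇ (adjB (E G) x) (V G))

_⇔_ : Set → Set → Set
A ⇔ B = (A → B) × (B → A)

data Reach (V : List ℕ) (E : List (ℕ × ℕ)) : ℕ → ℕ → Set where
  here : ∀ {u} → u ∈ V → Reach V E u u
  step : ∀ {u w z} → u ∈ V → Adj E u w → Reach V E w z → Reach V E u z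

-- (V, E) has exactly c connected components: the components are in bijection
-- with Fin c via a labelling comp (same label iff same component, every label used).
HasComponents : List ℕ → List (ℕ × ℕ) → ℕ → Set
HasComponents V E c =
  Σ (ℕ → Fin c) λ comp →
    (∀ (j : Fin c) → ∃ λ u → (u ∈ V) × (comp u ≡ j)) ×
    (∀ u w → u ∈ V → w ∈ V → ((comp u ≡ comp w) ⇔ Reach V E u w))

data Consec : List ℕ → ℕ → ℕ → Set where
  hereF : ∀ {u w p} → Consec (u ∷ w ∷ p) u w
  hereB : ∀ {u w p} → Consec (u ∷ w ∷ p) w u
  there : ∀ {a p u w} → Consec p u w → Consec (a ∷ p) u w

-- The component of v is a path iff its vertices can be listed
-- without repetition as p₀,…,pₘ so that two of them are adjacent exactly when
-- consecutive in the list.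
IsLinearForest : Graph → Set
IsLinearForest G =
  ∀ v → v ∈ V G →
    Σ (List ℕ) λ p →
      Unique p ×
      (∀ u → (u ∈ p) ⇔ ((u ∈ V G) × Reach (V G) (E G) v u)) ×
      (∀ u w → u ∈ p → w ∈ p → (Adj (E G) u w ⇔ Consec p u w))

V-del : Graph → ℕ → List ℕ
V-del G x = filterᵇ (λ u → not (u ≡ᵇ x)) (V G)

E-del : Graph → ℕ → List (ℕ × ℕ)
E-del G x = filterᵇ (λ { (a , b) → not (a ≡ᵇ x) ∧ not (b ≡ᵇ x) }) (E G)

CycAdj₁ : ℕ → ℕ → ℕ → Set
CycAdj₁ n a b = (suc a ≡ b) ⊎ ((suc a ≡ n) × (b ≡ 0))

CycAdj : ℕ → ℕ → ℕ → Set
CycAdj n a b = CycAdj₁ n a b ⊎ CycAdj₁ n b a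

IsoToCycle : List ℕ → List (ℕ × ℕ) → ℕ → Set
IsoToCycle VH EH n =
  Σ (ℕ → ℕ) λ f →
    (∀ u → u ∈ VH → f u < n) ×
    (∀ u w → u ∈ VH → w ∈ VH → f u ≡ f w → u ≡ w) ×
    (∀ i → i < n → ∃ λ u → (u ∈ VH) × (f u ≡ i)) ×
    (∀ u w → u ∈ VH → w ∈ VH → (Adj EH u w ⇔ CycAdj n (f u) (f w)))

unionSize : List ℕ → List ℕ → ℕ
unionSize A B = length (deduplicate _≟_ (A ++ B))

module Submission where

-- List each forest as its component paths (a path cover); there are as
-- many paths as components.  Rotate the cover of Lᵢ so that its first path is
-- Aᵢ ++ x ∷ Bᵢ.  The degree of x in Lᵢ is the number of nonempty pieces among
-- Aᵢ, Bᵢ, and L₂ - x is covered by those pieces and the other paths of L₂.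
-- Since x has degree 2 in total, the two paths through x glue at x into one path,
-- the spine: x is interior to one of them and alone on the other, or an end
-- of both.  In each case the component counts make the remaining paths of L₁
-- and L₂ interleave so that the closed walk "spine, path, path, …, back to the
-- spine" changes forest at every seam; the seams, oriented from L₁ to L₂, are
-- the new edges E′, and numbering vertices by their position along the walk
-- is the isomorphism with C_{2k}.

open import Defs
open import Data.Bool using (Bool; true; false; not; T; _∧_; _∨_)
open import Data.Bool.Properties using (T-∨; T-∧; T-≡; not-involutive)
open import Data.Empty using (⊥; ⊥-elim)
open import Data.Fin using (Fin)
open import Data.Nat using (ℕ; zero; suc; _+_; _*_; _≤_; _<_; _≡ᵇ_; z≤n; s≤s; s<s⁻¹)
open import Data.Nat.Properties
  using (_≟_; ≡ᵇ⇒≡; ≡⇒≡ᵇ; suc-injective; +-identityʳ; +-comm; +-assoc; <⇒≱; m≤m+n)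
open import Data.List using (List; []; _∷_; length; _++_; reverse; concat; map; allFin; filterᵇ)
open import Data.List.Properties
  using (unfold-reverse; reverse-involutive; reverse-++; length-map; length-tabulate; length-++;
         ++-identityʳ; concat-++)
open import Data.List.Membership.Propositional using (_∈_; _∉_; find; lose)
open import Data.List.Membership.Propositional.Properties
  using (∈-++⁺ˡ; ∈-++⁺ʳ; ∈-++⁻; ∈-concat⁺′; ∈-concat⁻′; ∈-map⁺; ∈-map⁻; ∈-allFin;
         ∈-deduplicate⁺; ∈-deduplicate⁻; ∈-∃++; ∈-filter⁺; ∈-filter⁻)
open import Data.List.Membership.Propositional.Properties.WithK using (unique∧set⇒bag)
open import Data.List.Membership.DecPropositional _≟_ using (_∈?_)
open import Data.List.Relation.Binary.BagAndSetEquality using (∼bag⇒↭)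
open import Data.List.Relation.Binary.Disjoint.Propositional using (Disjoint)
open import Data.List.Relation.Binary.Permutation.Propositional
  using (_↭_; ↭-refl; ↭-sym; ↭-trans; ↭-prep; ↭⇒↭ₛ)
open import Data.List.Relation.Binary.Permutation.Propositional.Properties
  using (↭-length; ↭-reverse; All-resp-↭; Any-resp-↭; ∈-resp-↭; shift; ++-comm)
import Data.List.Relation.Binary.Permutation.Setoid.Properties as Permₛ
open import Data.List.Relation.Unary.Any using (Any; here; there)
import Data.List.Relation.Unary.Any as Any
import Data.List.Relation.Unary.Any.Properties as Anyₚ
open import Data.List.Relation.Unary.All using (All; []; _∷_)
import Data.List.Relation.Unary.All as All
import Data.List.Relation.Unary.All.Properties as Allₚ
open import Data.List.Relation.Unary.AllPairs using (AllPairs; []; _∷_)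
import Data.List.Relation.Unary.AllPairs as AllPairs
import Data.List.Relation.Unary.AllPairs.Properties as AllPairsₚ
open import Data.List.Relation.Unary.Unique.Propositional using (Unique)
open import Data.List.Relation.Unary.Unique.Propositional.Properties using (allFin⁺; filter⁺; concat⁺; ++⁺)
open import Data.List.Relation.Unary.Unique.DecPropositional.Properties _≟_ using (deduplicate-!)
open import Data.Product using (Σ; ∃; _×_; _,_; proj₁; proj₂)
open import Data.Sum using (_⊎_; inj₁; inj₂; [_,_]′)
import Data.Sum
open import Function.Base using (case_of_; _∘_)
open import Function.Bundles using (Equivalence; mk⇔)
open import Relation.Nullary using (yes; no)
open import Relation.Nullary.Decidable using (T?)
open import Relation.Binary.PropositionalEquality
  using (_≡_; _≢_; refl; sym; trans; cong; cong₂; subst; setoid; module ≡-Reasoning)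

Match : ℕ × ℕ → ℕ → ℕ → Set
Match (a , b) u w = (a ≡ u × b ≡ w) ⊎ (a ≡ w × b ≡ u)

match-sym : ∀ e {u w} → Match e u w → Match e w u
match-sym e (inj₁ (p , q)) = inj₂ (p , q)
match-sym e (inj₂ (p , q)) = inj₁ (p , q)

-- The Boolean edge test underlying `adjB`; `adjB E u w` is definitionally
-- `any (edgeTest u w) E`.
edgeTest : ℕ → ℕ → ℕ × ℕ → Bool
edgeTest u w (a , b) = ((a ≡ᵇ u) ∧ (b ≡ᵇ w)) ∨ ((a ≡ᵇ w) ∧ (b ≡ᵇ u))

edgeTest⇒Match : ∀ {u w} e → T (edgeTest u w e) → Match e u w
edgeTest⇒Match {u} {w} (a , b) t with Equivalence.to T-∨ t
... | inj₁ t₁ = let p , q = Equivalence.to T-∧ t₁ in inj₁ (≡ᵇ⇒≡ a u p , ≡ᵇ⇒≡ b w q)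
... | inj₂ t₂ = let p , q = Equivalence.to T-∧ t₂ in inj₂ (≡ᵇ⇒≡ a w p , ≡ᵇ⇒≡ b u q)

Match⇒edgeTest : ∀ {u w} e → Match e u w → T (edgeTest u w e)
Match⇒edgeTest (a , b) (inj₁ (refl , refl)) =
  Equivalence.from T-∨ (inj₁ (Equivalence.from T-∧ (≡⇒≡ᵇ a a refl , ≡⇒≡ᵇ b b refl)))
Match⇒edgeTest (a , b) (inj₂ (refl , refl)) =
  Equivalence.from T-∨ (inj₂ (Equivalence.from T-∧ (≡⇒≡ᵇ a a refl , ≡⇒≡ᵇ b b refl)))

Adj⇒Any : ∀ E {u w} → Adj E u w → Any (λ e → Match e u w) E
Adj⇒Any E adj = Any.map (λ {e} → edgeTest⇒Match e) (Anyₚ.any⁻ (edgeTest _ _) E (Equivalence.from T-≡ adj))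

Any⇒Adj : ∀ E {u w} → Any (λ e → Match e u w) E → Adj E u w
Any⇒Adj E m = Equivalence.to T-≡ (Anyₚ.any⁺ (edgeTest _ _) (Any.map (λ {e} → Match⇒edgeTest e) m))

adj-sym : ∀ E {u w} → Adj E u w → Adj E w u
adj-sym E a = Any⇒Adj E (Any.map (λ {e} → match-sym e) (Adj⇒Any E a))

adj-++⇔ : ∀ E F {u w} → Adj (E ++ F) u w ⇔ (Adj E u w ⊎ Adj F u w)
adj-++⇔ E F = (λ a → Data.Sum.map (Any⇒Adj E) (Any⇒Adj F) (Anyₚ.++⁻ E (Adj⇒Any (E ++ F) a)))
            , [ (λ a → Any⇒Adj (E ++ F) (Anyₚ.++⁺ˡ (Adj⇒Any E a))) , (λ a → Any⇒Adj (E ++ F) (Anyₚ.++⁺ʳ E (Adj⇒Any F a))) ]′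

adj-vertices : ∀ (G : Graph) {u w} → Adj (E G) u w → (u ∈ V G) × (w ∈ V G)
adj-vertices G a with find (Adj⇒Any (E G) a)
... | _ , e∈ , inj₁ (refl , refl) = edgesIn G e∈
... | _ , e∈ , inj₂ (refl , refl) = let a , b = edgesIn G e∈ in b , a

adj-irrefl : ∀ (G : Graph) {u} → Adj (E G) u u → ⊥
adj-irrefl G a with find (Adj⇒Any (E G) a)
... | _ , e∈ , inj₁ (refl , refl) = noLoop G e∈ refl
... | _ , e∈ , inj₂ (refl , refl) = noLoop G e∈ refl

⇔-trans : ∀ {A B C : Set} → A ⇔ B → B ⇔ C → A ⇔ C
⇔-trans (f , g) (h , k) = (λ a → h (f a)) , (λ c → g (k c))

⇔-sym : ∀ {A B : Set} → A ⇔ B → B ⇔ A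
⇔-sym (f , g) = g , f

⊎-⇔ : ∀ {A B C D : Set} → A ⇔ B → C ⇔ D → (A ⊎ C) ⇔ (B ⊎ D)
⊎-⇔ (f , g) (h , k) = [ inj₁ ∘ f , inj₂ ∘ h ]′ , [ inj₁ ∘ g , inj₂ ∘ k ]′

reach-target : ∀ {V E u w} → Reach V E u w → w ∈ V
reach-target (here i) = i
reach-target (step _ _ r) = reach-target r

reach-trans : ∀ {V E u w z} → Reach V E u w → Reach V E w z → Reach V E u z
reach-trans (here _) r = r
reach-trans (step i a r) r′ = step i a (reach-trans r r′)

reach-snoc : ∀ {V E u w z} → Reach V E u w → Adj E w z → z ∈ V → Reach V E u z
reach-snoc r a z∈ = reach-trans r (step (reach-target r) a (here z∈))

reach-sym : ∀ {V E u w} → Reach V E u w → Reach V E w u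
reach-sym (here i) = here i
reach-sym {E = E} (step i a r) = reach-snoc (reach-sym r) (adj-sym E a) i

unique-length : {A : Set} {xs ys : List A} → Unique xs → Unique ys →
  (∀ {v} → v ∈ xs → v ∈ ys) → (∀ {v} → v ∈ ys → v ∈ xs) → length xs ≡ length ys
unique-length u u′ f g = ↭-length (∼bag⇒↭ (unique∧set⇒bag u u′ (mk⇔ f g)))

unique-++⁻ : ∀ (xs : List ℕ) {ys} → Unique (xs ++ ys) → Unique xs × Unique ys × Disjoint xs ys
unique-++⁻ [] u = [] , u , λ ()
unique-++⁻ (x ∷ xs) (x∉ ∷ u) with unique-++⁻ xs u
... | uxs , uys , d = (Allₚ.++⁻ˡ xs x∉ ∷ uxs) , uys , disjoint
  where disjoint : Disjoint (x ∷ xs) _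
        disjoint (here refl , j) = All.lookup (Allₚ.++⁻ʳ xs x∉) j refl
        disjoint (there i , j) = d (i , j)

unique-reverse : ∀ {xs : List ℕ} → Unique xs → Unique (reverse xs)
unique-reverse {xs} = Permₛ.Unique-resp-↭ (setoid ℕ) (↭⇒↭ₛ (↭-sym (↭-reverse xs)))

disjoint-resp-↭ : ∀ {ps qs : List (List ℕ)} → ps ↭ qs → AllPairs Disjoint ps → AllPairs Disjoint qs
disjoint-resp-↭ σ = Permₛ.AllPairs-resp-↭ (setoid (List ℕ)) (λ d {v} (i , j) → d (j , i))
  ((λ { refl d → d }) , (λ { refl d → d })) (↭⇒↭ₛ σ)

data NonEmpty : List ℕ → Set where
  nonEmpty : ∀ {v vs} → NonEmpty (v ∷ vs)

∈⇒NonEmpty : ∀ {v : ℕ} {vs} → v ∈ vs → NonEmpty vs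
∈⇒NonEmpty (here _) = nonEmpty
∈⇒NonEmpty (there _) = nonEmpty

-- first and final vertex of a path (0 for the empty list, which never occurs as a path)
first : List ℕ → ℕ
first [] = 0
first (v ∷ _) = v

final : List ℕ → ℕ
final [] = 0
final (v ∷ []) = v
final (_ ∷ w ∷ vs) = final (w ∷ vs)

first∈ : ∀ {p} → NonEmpty p → first p ∈ p
first∈ nonEmpty = here refl

final∈ : ∀ {p} → NonEmpty p → final p ∈ p
final∈ {_ ∷ []} nonEmpty = here refl
final∈ {_ ∷ _ ∷ _} nonEmpty = there (final∈ nonEmpty)

final-++ : ∀ xs {y ys} → final (xs ++ y ∷ ys) ≡ final (y ∷ ys)
final-++ [] = refl
final-++ (_ ∷ []) = refl
final-++ (_ ∷ x′ ∷ xs) = final-++ (x′ ∷ xs)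

consec-sym : ∀ {p u w} → Consec p u w → Consec p w u
consec-sym hereF = hereB
consec-sym hereB = hereF
consec-sym (there c) = there (consec-sym c)

consec-∈ : ∀ {p u w} → Consec p u w → (u ∈ p) × (w ∈ p)
consec-∈ hereF = here refl , there (here refl)
consec-∈ hereB = there (here refl) , here refl
consec-∈ (there c) = let i , j = consec-∈ c in there i , there j

consec-≡ : ∀ {p q u w} → p ≡ q → Consec p u w ⇔ Consec q u w
consec-≡ refl = (λ c → c) , (λ c → c)

consec-singleton : ∀ {v u w} → Consec (v ∷ []) u w → ⊥
consec-singleton (there ())

consec-++ˡ : ∀ {xs} ys {u w} → Consec xs u w → Consec (xs ++ ys) u w
consec-++ˡ ys hereF = hereF
consec-++ˡ ys hereB = hereB
consec-++ˡ ys (there c) = there (consec-++ˡ ys c)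

consec-++ʳ : ∀ xs {ys u w} → Consec ys u w → Consec (xs ++ ys) u w
consec-++ʳ [] c = c
consec-++ʳ (_ ∷ xs) c = there (consec-++ʳ xs c)

consec-seam : ∀ xs {y ys u w} → NonEmpty xs → Match (final xs , y) u w → Consec (xs ++ y ∷ ys) u w
consec-seam (_ ∷ []) nonEmpty (inj₁ (refl , refl)) = hereF
consec-seam (_ ∷ []) nonEmpty (inj₂ (refl , refl)) = hereB
consec-seam (_ ∷ x′ ∷ xs) nonEmpty m = there (consec-seam (x′ ∷ xs) nonEmpty m)

consec-++⁻ : ∀ xs {y ys u w} → Consec (xs ++ y ∷ ys) u w →
  Consec xs u w ⊎ Consec (y ∷ ys) u w ⊎ (NonEmpty xs × Match (final xs , y) u w)
consec-++⁻ [] c = inj₂ (inj₁ c)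
consec-++⁻ (_ ∷ []) hereF = inj₂ (inj₂ (nonEmpty , inj₁ (refl , refl)))
consec-++⁻ (_ ∷ []) hereB = inj₂ (inj₂ (nonEmpty , inj₂ (refl , refl)))
consec-++⁻ (_ ∷ []) (there c) = inj₂ (inj₁ c)
consec-++⁻ (_ ∷ _ ∷ _) hereF = inj₁ hereF
consec-++⁻ (_ ∷ _ ∷ _) hereB = inj₁ hereB
consec-++⁻ (_ ∷ x′ ∷ xs) (there c) with consec-++⁻ (x′ ∷ xs) c
... | inj₁ d = inj₁ (there d)
... | inj₂ (inj₁ d) = inj₂ (inj₁ d)
... | inj₂ (inj₂ (_ , m)) = inj₂ (inj₂ (nonEmpty , m))

reverse-nonEmpty : ∀ b r → NonEmpty (reverse (b ∷ r))
reverse-nonEmpty b r = subst NonEmpty (sym (unfold-reverse b r)) (snoc (reverse r))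
  where snoc : ∀ xs → NonEmpty (xs ++ b ∷ [])
        snoc [] = nonEmpty
        snoc (_ ∷ _) = nonEmpty

final-reverse : ∀ b r → final (reverse (b ∷ r)) ≡ b
final-reverse b r = trans (cong final (unfold-reverse b r)) (final-++ (reverse r))

consec-reverse : ∀ {p u w} → Consec p u w → Consec (reverse p) u w
consec-reverse {a ∷ p} c = subst (λ q → Consec q _ _) (sym (unfold-reverse a p)) (consec-reverse-∷ c)
  where
    consec-reverse-∷ : ∀ {p u w} → Consec (a ∷ p) u w → Consec (reverse p ++ a ∷ []) u w
    consec-reverse-∷ {b ∷ r} hereF =
      consec-seam (reverse (b ∷ r)) (reverse-nonEmpty b r) (inj₂ (final-reverse b r , refl))
    consec-reverse-∷ {b ∷ r} hereB =
      consec-seam (reverse (b ∷ r)) (reverse-nonEmpty b r) (inj₁ (final-reverse b r , refl))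
    consec-reverse-∷ (there d) = consec-++ˡ (a ∷ []) (consec-reverse d)

consec-reverse⁻ : ∀ {p u w} → Consec (reverse p) u w → Consec p u w
consec-reverse⁻ {p} c = subst (λ q → Consec q _ _) (reverse-involutive p) (consec-reverse c)

record PathCover (V : List ℕ) (E : List (ℕ × ℕ)) (ps : List (List ℕ)) : Set where
  field
    nonEmptyPaths : All NonEmpty ps
    uniquePaths   : All Unique ps
    disjointPaths : AllPairs Disjoint ps
    inside        : ∀ {p u} → p ∈ ps → u ∈ p → u ∈ V
    covers        : ∀ {u} → u ∈ V → ∃ λ p → p ∈ ps × u ∈ p
    adjacent      : ∀ {p u w} → p ∈ ps → u ∈ p → Adj E u w ⇔ Consec p u w

-- Every linear forest has a path cover: list the component paths it provides,
-- skipping vertices whose component has already been listed.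
module Decomposition (G : Graph) (forest : IsLinearForest G) where

  ComponentPath : List ℕ → Set
  ComponentPath p = Σ ℕ λ v → (v ∈ V G) × Unique p ×
    (∀ u → (u ∈ p) ⇔ ((u ∈ V G) × Reach (V G) (E G) v u)) ×
    (∀ u w → u ∈ p → w ∈ p → (Adj (E G) u w ⇔ Consec p u w))

  componentOf : ∀ {v} → v ∈ V G → Σ (List ℕ) λ p → ComponentPath p × v ∈ p
  componentOf {v} v∈ =
    let p , u , members , links = forest v v∈
    in p , (v , v∈ , u , members , links) , proj₂ (members v) (v∈ , here v∈)

  component-shared : ∀ {p q z} (cp : ComponentPath p) → ComponentPath q → z ∈ p → z ∈ q → proj₁ cp ∈ q
  component-shared {z = z} (v , v∈ , _ , members , _) (_ , _ , _ , members′ , _) z∈p z∈q =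
    proj₂ (members′ v) (v∈ , reach-trans (proj₂ (proj₁ (members′ z) z∈q)) (reach-sym (proj₂ (proj₁ (members z) z∈p))))

  component-nonEmpty : ∀ {p} → ComponentPath p → NonEmpty p
  component-nonEmpty (v , v∈ , _ , members , _) = ∈⇒NonEmpty (proj₂ (members v) (v∈ , here v∈))

  component-inside : ∀ {p u} → ComponentPath p → u ∈ p → u ∈ V G
  component-inside (_ , _ , _ , members , _) u∈ = proj₁ (proj₁ (members _) u∈)

  -- a component is closed under adjacency, so its links are all the edges at its vertices
  component-adjacent : ∀ {p u w} → ComponentPath p → u ∈ p → Adj (E G) u w ⇔ Consec p u w
  component-adjacent {p} {u} {w} (_ , _ , _ , members , links) u∈ = to , from
    where
      to : Adj (E G) u w → Consec p u w
      to a = let w∈V = proj₂ (adj-vertices G a)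
                 w∈p = proj₂ (members w) (w∈V , reach-snoc (proj₂ (proj₁ (members u) u∈)) a w∈V)
             in proj₁ (links u w u∈ w∈p) a
      from : Consec p u w → Adj (E G) u w
      from c = proj₂ (links u w u∈ (proj₂ (consec-∈ c))) c

  Family : List (List ℕ) → Set
  Family ps = All ComponentPath ps × AllPairs Disjoint ps

  collect : (vs : List ℕ) → (∀ {v} → v ∈ vs → v ∈ V G) → ∀ acc → Family acc →
    Σ (List (List ℕ)) λ ps → Family ps × (∀ {u} → u ∈ vs ⊎ u ∈ concat acc → u ∈ concat ps)
  collect [] _ acc fam = acc , fam , λ { (inj₂ i) → i }
  collect (v ∷ vs) sub acc fam with v ∈? concat acc
  ... | yes v∈acc = ps , fam′ , covered
    where
      rest = collect vs (λ i → sub (there i)) acc fam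
      ps = proj₁ rest
      fam′ = proj₁ (proj₂ rest)
      covered : ∀ {u} → u ∈ v ∷ vs ⊎ u ∈ concat acc → u ∈ concat ps
      covered (inj₁ (here refl)) = proj₂ (proj₂ rest) (inj₂ v∈acc)
      covered (inj₁ (there i)) = proj₂ (proj₂ rest) (inj₁ i)
      covered (inj₂ i) = proj₂ (proj₂ rest) (inj₂ i)
  ... | no v∉acc = ps , fam′ , covered
    where
      new = componentOf (sub (here refl))
      p = proj₁ new
      cp = proj₁ (proj₂ new)
      fresh : ∀ {q} → q ∈ acc → Disjoint p q
      fresh q∈ (z∈p , z∈q) = v∉acc (∈-concat⁺′ (component-shared cp (All.lookup (proj₁ fam) q∈) z∈p z∈q) q∈)
      rest = collect vs (λ i → sub (there i)) (p ∷ acc) ((cp ∷ proj₁ fam) , (All.tabulate fresh ∷ proj₂ fam))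
      ps = proj₁ rest
      fam′ = proj₁ (proj₂ rest)
      covered : ∀ {u} → u ∈ v ∷ vs ⊎ u ∈ concat acc → u ∈ concat ps
      covered (inj₁ (here refl)) = proj₂ (proj₂ rest) (inj₂ (∈-++⁺ˡ (proj₂ (proj₂ new))))
      covered (inj₁ (there i)) = proj₂ (proj₂ rest) (inj₁ i)
      covered (inj₂ i) = proj₂ (proj₂ rest) (inj₂ (∈-++⁺ʳ p i))

  decompose : Σ (List (List ℕ)) (PathCover (V G) (E G))
  decompose = ps , record
    { nonEmptyPaths = All.map component-nonEmpty components
    ; uniquePaths   = All.map (λ cp → proj₁ (proj₂ (proj₂ cp))) components
    ; disjointPaths = disjoint
    ; inside        = λ p∈ u∈ → component-inside (All.lookup components p∈) u∈
    ; covers        = λ u∈ → let p , u∈p , p∈ = ∈-concat⁻′ ps (cov (inj₁ u∈)) in p , p∈ , u∈p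
    ; adjacent      = λ p∈ u∈ → component-adjacent (All.lookup components p∈) u∈
    }
    where
      collected = collect (V G) (λ i → i) [] ([] , [])
      ps = proj₁ collected
      components = proj₁ (proj₁ (proj₂ collected))
      disjoint = proj₂ (proj₁ (proj₂ collected))
      cov = proj₂ (proj₂ collected)

module _ {V : List ℕ} {E : List (ℕ × ℕ)} {ps : List (List ℕ)} (cover : PathCover V E ps) where
  open PathCover cover

  cover-vertices : ∀ {u} → (u ∈ V) ⇔ Any (u ∈_) ps
  cover-vertices = (λ u∈ → let p , p∈ , u∈p = covers u∈ in lose p∈ u∈p)
                 , (λ a → let p , p∈ , u∈p = find a in inside p∈ u∈p)

  cover-edges : (∀ {u w} → Adj E u w → u ∈ V) → ∀ {u w} → Adj E u w ⇔ Any (λ p → Consec p u w) ps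
  cover-edges endpoint = (λ a → let p , p∈ , u∈p = covers (endpoint a) in lose p∈ (proj₁ (adjacent p∈ u∈p) a))
                       , (λ a → let p , p∈ , c = find a in proj₂ (adjacent p∈ (proj₁ (consec-∈ c))) c)

  reach-within : ∀ {p u w} → p ∈ ps → Reach V E u w → u ∈ p → w ∈ p
  reach-within p∈ (here _) u∈ = u∈
  reach-within p∈ (step _ a r) u∈ = reach-within p∈ r (proj₂ (consec-∈ (proj₁ (adjacent p∈ u∈) a)))

  reach-along : ∀ {p u} → p ∈ ps → u ∈ p → Reach V E (first p) u
  reach-along {p} p∈ = along p (λ c → proj₂ (adjacent p∈ (proj₁ (consec-∈ c))) c) (inside p∈)
    where
      along : ∀ q → (∀ {a b} → Consec q a b → Adj E a b) → (∀ {a} → a ∈ q → a ∈ V) →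
              ∀ {u} → u ∈ q → Reach V E (first q) u
      along (a ∷ q) links sub (here refl) = here (sub (here refl))
      along (a ∷ b ∷ q) links sub (there i) =
        step (sub (here refl)) (links hereF) (along (b ∷ q) (λ c → links (there c)) (λ j → sub (there j)) i)

  -- A path cover has exactly one path per connected component: labelling each
  -- path by the component of its first vertex is a bijection onto Fin c.
  pathCover-count : ∀ {c} → HasComponents V E c → length ps ≡ c
  pathCover-count {c} (comp , onto , sameComp) = begin
      length ps             ≡⟨ sym (length-map label ps) ⟩
      length (map label ps) ≡⟨ unique-length (distinct (λ i → i) nonEmptyPaths disjointPaths) (allFin⁺ c)
                                 (λ _ → ∈-allFin _) labelled ⟩
      length (allFin c)     ≡⟨ length-tabulate (λ i → i) ⟩
      c                     ∎
    where
      open ≡-Reasoning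
      label : List ℕ → Fin c
      label p = comp (first p)

      first∈V : ∀ {p} → p ∈ ps → first p ∈ V
      first∈V p∈ = inside p∈ (first∈ (All.lookup nonEmptyPaths p∈))

      same-label : ∀ {p q} → p ∈ ps → q ∈ ps → label p ≡ label q → first q ∈ p
      same-label p∈ q∈ eq = reach-within p∈ (proj₁ (sameComp _ _ (first∈V p∈) (first∈V q∈)) eq)
                                         (first∈ (All.lookup nonEmptyPaths p∈))

      distinct : ∀ {qs} → (∀ {q} → q ∈ qs → q ∈ ps) → All NonEmpty qs → AllPairs Disjoint qs →
                 Unique (map label qs)
      distinct {[]} _ _ [] = []
      distinct {q ∷ qs} sub (_ ∷ ne) (d ∷ ds) =
        Allₚ.map⁺ (All.tabulate (λ {r} r∈ eq →
          All.lookup d r∈ (same-label (sub (here refl)) (sub (there r∈)) eq , first∈ (All.lookup ne r∈)))) ∷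
        distinct (λ i → sub (there i)) ne ds

      labelled : ∀ {j} → j ∈ allFin c → j ∈ map label ps
      labelled {j} _ =
        let u , u∈ , uj = onto j
            p , p∈ , u∈p = covers u∈
        in subst (_∈ map label ps) (trans (proj₂ (sameComp _ _ (first∈V p∈) u∈) (reach-along p∈ u∈p)) uj)
                 (∈-map⁺ label p∈)

pathCover-↭ : ∀ {V E ps qs} → ps ↭ qs → PathCover V E ps → PathCover V E qs
pathCover-↭ σ cover = record
  { nonEmptyPaths = All-resp-↭ σ nonEmptyPaths
  ; uniquePaths   = All-resp-↭ σ uniquePaths
  ; disjointPaths = disjoint-resp-↭ σ disjointPaths
  ; inside        = λ p∈ → inside (∈-resp-↭ (↭-sym σ) p∈)
  ; covers        = λ u∈ → let p , p∈ , u∈p = covers u∈ in p , ∈-resp-↭ σ p∈ , u∈p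
  ; adjacent      = λ p∈ → adjacent (∈-resp-↭ (↭-sym σ) p∈)
  }
  where open PathCover cover

record RootedCover (G : Graph) (x : ℕ) : Set where
  field
    before after : List ℕ
    others       : List (List ℕ)
    cover        : PathCover (V G) (E G) ((before ++ x ∷ after) ∷ others)

rootedCover : ∀ (G : Graph) {x} → IsLinearForest G → x ∈ V G → RootedCover G x
rootedCover G {x} forest x∈ with Decomposition.decompose G forest
... | ps , cover with PathCover.covers cover x∈
...   | p , p∈ , x∈p with ∈-∃++ p∈ | ∈-∃++ x∈p
...     | pre , post , refl | A , B , refl = record
  { before = A ; after = B ; others = pre ++ post ; cover = pathCover-↭ (shift _ pre post) cover }

T-≢ᵇ : ∀ {a x} → T (not (a ≡ᵇ x)) ⇔ (a ≢ x)
T-≢ᵇ {a} {x} with a ≡ᵇ x in eq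
... | true = (λ ()) , λ a≢x → a≢x (≡ᵇ⇒≡ a x (subst T (sym eq) _))
... | false = (λ _ a≡x → subst T eq (≡⇒≡ᵇ a x a≡x)) , (λ _ → _)

∈-V-del : ∀ G x {u} → (u ∈ V-del G x) ⇔ ((u ∈ V G) × (u ≢ x))
∈-V-del G x = (λ i → let u∈ , t = ∈-filter⁻ (λ z → T? _) {xs = V G} i in u∈ , proj₁ T-≢ᵇ t)
            , (λ (u∈ , u≢x) → ∈-filter⁺ (λ z → T? _) u∈ (proj₂ T-≢ᵇ u≢x))

adj-E-del : ∀ G x {u w} → Adj (E-del G x) u w ⇔ (Adj (E G) u w × (u ≢ x) × (w ≢ x))
adj-E-del G x {u} {w} = to , from
  where
    keep : ℕ × ℕ → Bool
    keep (a , b) = not (a ≡ᵇ x) ∧ not (b ≡ᵇ x)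
    to : Adj (E-del G x) u w → Adj (E G) u w × (u ≢ x) × (w ≢ x)
    to a with find (Adj⇒Any (E-del G x) a)
    ... | (p , q) , e∈ , m =
      let e∈E , t = ∈-filter⁻ (λ z → T? (keep z)) {xs = E G} e∈
          tp , tq = Equivalence.to T-∧ t
          p≢x = proj₁ T-≢ᵇ tp ; q≢x = proj₁ T-≢ᵇ tq
          ends : (u ≢ x) × (w ≢ x)
          ends = case m of λ { (inj₁ (refl , refl)) → p≢x , q≢x ; (inj₂ (refl , refl)) → q≢x , p≢x }
      in Any⇒Adj (E G) (lose e∈E m) , ends
    from : Adj (E G) u w × (u ≢ x) × (w ≢ x) → Adj (E-del G x) u w
    from (a , u≢x , w≢x) with find (Adj⇒Any (E G) a)
    ... | (p , q) , e∈ , m = Any⇒Adj (E-del G x) (lose (∈-filter⁺ (λ z → T? (keep z)) e∈ kept) m)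
      where kept : T (keep (p , q))
            kept = case m of λ
              { (inj₁ (refl , refl)) → Equivalence.from T-∧ (proj₂ T-≢ᵇ u≢x , proj₂ T-≢ᵇ w≢x)
              ; (inj₂ (refl , refl)) → Equivalence.from T-∧ (proj₂ T-≢ᵇ w≢x , proj₂ T-≢ᵇ u≢x) }

record Sides (A : List ℕ) (x : ℕ) (B : List ℕ) : Set where
  field
    uniqueA    : Unique A
    uniqueB    : Unique B
    x∉A        : x ∉ A
    x∉B        : x ∉ B
    disjointAB : Disjoint A B

sides : ∀ A {x B} → Unique (A ++ x ∷ B) → Sides A x B
sides A u = let uA , x∷B , d = unique-++⁻ A u in record
  { uniqueA = uA ; uniqueB = AllPairs.tail x∷B ; x∉A = λ i → d (i , here refl)
  ; x∉B = λ i → All.lookup (AllPairs.head x∷B) i refl ; disjointAB = λ (i , j) → d (i , there j) }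

neighbours : List ℕ → List ℕ → List ℕ
neighbours [] [] = []
neighbours [] (b ∷ _) = b ∷ []
neighbours (a ∷ A) [] = final (a ∷ A) ∷ []
neighbours (a ∷ A) (b ∷ _) = final (a ∷ A) ∷ b ∷ []

-- the nonempty ones among the pieces A, B left when x is deleted from A ++ x ∷ B
piece : List ℕ → List (List ℕ)
piece [] = []
piece (a ∷ A) = (a ∷ A) ∷ []

neighbours-length : ∀ A B → length (neighbours A B) ≡ length (piece A) + length (piece B)
neighbours-length [] [] = refl
neighbours-length [] (_ ∷ _) = refl
neighbours-length (_ ∷ _) [] = refl
neighbours-length (_ ∷ _) (_ ∷ _) = refl

neighbours-unique : ∀ A B → Disjoint A B → Unique (neighbours A B)
neighbours-unique [] [] _ = []
neighbours-unique [] (_ ∷ _) _ = [] ∷ []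
neighbours-unique (_ ∷ _) [] _ = [] ∷ []
neighbours-unique (a ∷ A) (b ∷ B) d =
  ((λ eq → d (subst (_∈ a ∷ A) eq (final∈ nonEmpty) , here refl)) ∷ []) ∷ [] ∷ []

consec-x⇒neighbour : ∀ A x B {z} → x ∉ A → x ∉ B → z ≢ x → Consec (A ++ x ∷ B) x z → z ∈ neighbours A B
consec-x⇒neighbour A x B x∉A x∉B z≢x c with consec-++⁻ A c
... | inj₁ d = ⊥-elim (x∉A (proj₁ (consec-∈ d)))
... | inj₂ (inj₁ hereB) = ⊥-elim (z≢x refl)
... | inj₂ (inj₁ (there d)) = ⊥-elim (x∉B (proj₁ (consec-∈ d)))
... | inj₂ (inj₂ (_ , inj₁ (_ , x≡z))) = ⊥-elim (z≢x (sym x≡z))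
consec-x⇒neighbour [] x (b ∷ B) _ _ _ _ | inj₂ (inj₁ hereF) = here refl
consec-x⇒neighbour (a ∷ A) x (b ∷ B) _ _ _ _ | inj₂ (inj₁ hereF) = there (here refl)
consec-x⇒neighbour (a ∷ A) x [] _ _ _ _ | inj₂ (inj₂ (_ , inj₂ (refl , _))) = here refl
consec-x⇒neighbour (a ∷ A) x (b ∷ B) _ _ _ _ | inj₂ (inj₂ (_ , inj₂ (refl , _))) = here refl

neighbour⇒consec-x : ∀ A x B {z} → z ∈ neighbours A B → Consec (A ++ x ∷ B) x z
neighbour⇒consec-x [] x (b ∷ _) (here refl) = hereF
neighbour⇒consec-x (a ∷ A) x [] (here refl) = consec-seam (a ∷ A) nonEmpty (inj₂ (refl , refl))
neighbour⇒consec-x (a ∷ A) x (b ∷ _) (here refl) = consec-seam (a ∷ A) nonEmpty (inj₂ (refl , refl))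
neighbour⇒consec-x (a ∷ A) x (b ∷ _) (there (here refl)) = consec-++ʳ (a ∷ A) hereF

consec-before : ∀ {A x B u w} → Sides A x B → u ∈ A → w ≢ x → Consec (A ++ x ∷ B) u w → Consec A u w
consec-before {A} s u∈ w≢x c with consec-++⁻ A c
... | inj₁ d = d
... | inj₂ (inj₁ d) with proj₁ (consec-∈ d)
...   | here refl = ⊥-elim (Sides.x∉A s u∈)
...   | there i = ⊥-elim (Sides.disjointAB s (u∈ , i))
consec-before s u∈ w≢x c | inj₂ (inj₂ (_ , inj₁ (_ , x≡w))) = ⊥-elim (w≢x (sym x≡w))
consec-before s u∈ w≢x c | inj₂ (inj₂ (_ , inj₂ (_ , refl))) = ⊥-elim (Sides.x∉A s u∈)

consec-after : ∀ {A x B u w} → Sides A x B → u ∈ B → w ≢ x → Consec (A ++ x ∷ B) u w → Consec B u w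
consec-after {A} s u∈ w≢x c with consec-++⁻ A c
... | inj₁ d = ⊥-elim (Sides.disjointAB s (proj₁ (consec-∈ d) , u∈))
... | inj₂ (inj₁ hereF) = ⊥-elim (Sides.x∉B s u∈)
... | inj₂ (inj₁ hereB) = ⊥-elim (w≢x refl)
... | inj₂ (inj₁ (there d)) = d
... | inj₂ (inj₂ (_ , inj₁ (_ , x≡w))) = ⊥-elim (w≢x (sym x≡w))
... | inj₂ (inj₂ (_ , inj₂ (_ , refl))) = ⊥-elim (Sides.x∉B s u∈)

piece-∈⁻ : ∀ A {T} → T ∈ piece A → (T ≡ A) × NonEmpty A
piece-∈⁻ (_ ∷ _) (here refl) = refl , nonEmpty

piece-∈⁺ : ∀ {A} → NonEmpty A → A ∈ piece A
piece-∈⁺ nonEmpty = here refl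

All-piece : ∀ {Q : List ℕ → Set} A → (NonEmpty A → Q A) → All Q (piece A)
All-piece [] _ = []
All-piece (_ ∷ _) q = q nonEmpty ∷ []

AllPairs-piece : ∀ {R : List ℕ → List ℕ → Set} A → AllPairs R (piece A)
AllPairs-piece [] = []
AllPairs-piece (_ ∷ _) = [] ∷ []

module _ {G : Graph} {x : ℕ} (R : RootedCover G x) where
  open RootedCover R renaming (before to A; after to B)
  open PathCover cover

  sidesAB : Sides A x B
  sidesAB = sides A (All.head uniquePaths)
  open Sides sidesAB

  degree-root : degree G x ≡ length (piece A) + length (piece B)
  degree-root = trans (unique-length (filter⁺ (λ z → T? _) (uniqueV G)) (neighbours-unique A B disjointAB) to from)
                      (neighbours-length A B)
    where
      to : ∀ {z} → z ∈ filterᵇ (adjB (E G) x) (V G) → z ∈ neighbours A B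
      to i = let z∈ , t = ∈-filter⁻ (λ z → T? _) {xs = V G} i
                 a = Equivalence.to T-≡ t
             in consec-x⇒neighbour A x B x∉A x∉B (λ { refl → adj-irrefl G a })
                  (proj₁ (adjacent (here refl) (∈-++⁺ʳ A (here refl))) a)
      from : ∀ {z} → z ∈ neighbours A B → z ∈ filterᵇ (adjB (E G) x) (V G)
      from i = let c = neighbour⇒consec-x A x B i
               in ∈-filter⁺ (λ z → T? _) (inside (here refl) (proj₂ (consec-∈ c)))
                            (Equivalence.from T-≡ (proj₂ (adjacent (here refl) (∈-++⁺ʳ A (here refl))) c))

  deletedPaths : List (List ℕ)
  deletedPaths = piece A ++ piece B ++ others

  deletedPaths-length : length deletedPaths ≡ (length (piece A) + length (piece B)) + length others
  deletedPaths-length = trans (trans (length-++ (piece A)) (cong (length (piece A) +_) (length-++ (piece B))))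
                              (sym (+-assoc (length (piece A)) _ _))

  root-others : All (Disjoint (A ++ x ∷ B)) others
  root-others = AllPairs.head disjointPaths

  deleted-kind : ∀ {T} → T ∈ deletedPaths → (T ≡ A × NonEmpty A) ⊎ (T ≡ B × NonEmpty B) ⊎ T ∈ others
  deleted-kind T∈ with ∈-++⁻ (piece A) T∈
  ... | inj₁ i = inj₁ (piece-∈⁻ A i)
  ... | inj₂ j with ∈-++⁻ (piece B) j
  ...   | inj₁ i = inj₂ (inj₁ (piece-∈⁻ B i))
  ...   | inj₂ k = inj₂ (inj₂ k)

  deleted-avoids-x : ∀ {T u} → T ∈ deletedPaths → u ∈ T → (u ∈ V G) × (u ≢ x)
  deleted-avoids-x T∈ u∈ with deleted-kind T∈
  ... | inj₁ (refl , _) = inside (here refl) (∈-++⁺ˡ u∈) , λ { refl → x∉A u∈ }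
  ... | inj₂ (inj₁ (refl , _)) = inside (here refl) (∈-++⁺ʳ A (there u∈)) , λ { refl → x∉B u∈ }
  ... | inj₂ (inj₂ i) = inside (there i) u∈ , λ { refl → All.lookup root-others i (∈-++⁺ʳ A (here refl) , u∈) }

  deletion-cover : PathCover (V-del G x) (E-del G x) deletedPaths
  deletion-cover = record
    { nonEmptyPaths = Allₚ.++⁺ (All-piece A (λ n → n)) (Allₚ.++⁺ (All-piece B (λ n → n)) (All.tail nonEmptyPaths))
    ; uniquePaths   = Allₚ.++⁺ (All-piece A (λ _ → uniqueA)) (Allₚ.++⁺ (All-piece B (λ _ → uniqueB)) (All.tail uniquePaths))
    ; disjointPaths =
        AllPairsₚ.++⁺ (AllPairs-piece A)
          (AllPairsₚ.++⁺ (AllPairs-piece B) (AllPairs.tail disjointPaths) (All-piece B (λ _ → All.tabulate B-others)))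
          (All-piece A (λ _ → Allₚ.++⁺ (All-piece B (λ _ → disjointAB)) (All.tabulate A-others)))
    ; inside        = λ T∈ u∈ → proj₂ (∈-V-del G x) (deleted-avoids-x T∈ u∈)
    ; covers        = covered
    ; adjacent      = λ T∈ u∈ → to T∈ u∈ , from T∈
    }
    where
      A-others : ∀ {T} → T ∈ others → Disjoint A T
      A-others T∈ (i , j) = All.lookup root-others T∈ (∈-++⁺ˡ i , j)
      B-others : ∀ {T} → T ∈ others → Disjoint B T
      B-others T∈ (i , j) = All.lookup root-others T∈ (∈-++⁺ʳ A (there i) , j)

      to : ∀ {T u w} → T ∈ deletedPaths → u ∈ T → Adj (E-del G x) u w → Consec T u w
      to T∈ u∈ a with proj₁ (adj-E-del G x) a | deleted-kind T∈
      ... | a′ , _ , w≢x | inj₁ (refl , _) = consec-before sidesAB u∈ w≢x (proj₁ (adjacent (here refl) (∈-++⁺ˡ u∈)) a′)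
      ... | a′ , _ , w≢x | inj₂ (inj₁ (refl , _)) = consec-after sidesAB u∈ w≢x (proj₁ (adjacent (here refl) (∈-++⁺ʳ A (there u∈))) a′)
      ... | a′ , _ , _ | inj₂ (inj₂ i) = proj₁ (adjacent (there i) u∈) a′

      from : ∀ {T u w} → T ∈ deletedPaths → Consec T u w → Adj (E-del G x) u w
      from T∈ c = let u∈ , w∈ = consec-∈ c in
        proj₂ (adj-E-del G x) (in-G T∈ c , proj₂ (deleted-avoids-x T∈ u∈) , proj₂ (deleted-avoids-x T∈ w∈))
        where
          in-G : ∀ {T u w} → T ∈ deletedPaths → Consec T u w → Adj (E G) u w
          in-G T∈ c with deleted-kind T∈
          ... | inj₁ (refl , _) = proj₂ (adjacent (here refl) (∈-++⁺ˡ (proj₁ (consec-∈ c)))) (consec-++ˡ (x ∷ B) c)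
          ... | inj₂ (inj₁ (refl , _)) = proj₂ (adjacent (here refl) (∈-++⁺ʳ A (there (proj₁ (consec-∈ c))))) (consec-++ʳ A (there c))
          ... | inj₂ (inj₂ i) = proj₂ (adjacent (there i) (proj₁ (consec-∈ c))) c

      covered : ∀ {u} → u ∈ V-del G x → ∃ λ T → T ∈ deletedPaths × u ∈ T
      covered u∈ with proj₁ (∈-V-del G x) u∈
      ... | u∈V , u≢x with covers u∈V
      ...   | T , there T∈ , u∈T = T , ∈-++⁺ʳ (piece A) (∈-++⁺ʳ (piece B) T∈) , u∈T
      ...   | _ , here refl , u∈P with ∈-++⁻ A u∈P
      ...     | inj₁ i = A , ∈-++⁺ˡ (piece-∈⁺ (∈⇒NonEmpty i)) , i
      ...     | inj₂ (here refl) = ⊥-elim (u≢x refl)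
      ...     | inj₂ (there i) = B , ∈-++⁺ʳ (piece A) (∈-++⁺ˡ (piece-∈⁺ (∈⇒NonEmpty i))) , i

record SamePath (P L : List ℕ) : Set where
  field
    members : ∀ {u} → (u ∈ L) ⇔ (u ∈ P)
    links   : ∀ {u w} → Consec L u w ⇔ Consec P u w
    uniqueL : Unique L

samePath-refl : ∀ {P} → Unique P → SamePath P P
samePath-refl u = record { members = (λ i → i) , (λ i → i) ; links = (λ c → c) , (λ c → c) ; uniqueL = u }

samePath-reverse : ∀ {P L} → SamePath P L → SamePath P (reverse L)
samePath-reverse s = record
  { members = ⇔-trans ((λ i → ∈-resp-↭ (↭-reverse _) i) , ∈-resp-↭ (↭-sym (↭-reverse _))) members
  ; links   = ⇔-trans (consec-reverse⁻ , consec-reverse) links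
  ; uniqueL = unique-reverse uniqueL }
  where open SamePath s

samePath-≡ : ∀ {P L L′} → L ≡ L′ → SamePath P L → SamePath P L′
samePath-≡ refl s = s

-- How x sits on its path A ++ x ∷ B, indexed by its degree: alone, at an end
-- (the path read towards x), or inside (with vertices on both sides).
data Placement (x : ℕ) (P : List ℕ) : ℕ → Set where
  alone    : SamePath P (x ∷ []) → Placement x P 0
  endpoint : ∀ X → NonEmpty X → SamePath P (X ++ x ∷ []) → Placement x P 1
  interior : ∀ a A B → NonEmpty B → SamePath P ((a ∷ A) ++ x ∷ B) → Placement x P 2

placement : ∀ A x B → Unique (A ++ x ∷ B) → Placement x (A ++ x ∷ B) (length (piece A) + length (piece B))
placement [] x [] u = alone (samePath-refl u)
placement [] x (b ∷ B) u =
  endpoint (reverse (b ∷ B)) (reverse-nonEmpty b B) (samePath-≡ (unfold-reverse x (b ∷ B)) (samePath-reverse (samePath-refl u)))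
placement (a ∷ A) x [] u = endpoint (a ∷ A) nonEmpty (samePath-refl u)
placement (a ∷ A) x (b ∷ B) u = interior a A (b ∷ B) nonEmpty (samePath-refl u)

final-inner : ∀ A {x B} → NonEmpty B → final (A ++ x ∷ B) ≡ final B
final-inner A nonEmpty = final-++ A

∈-joined : ∀ (X : List ℕ) {x Y u} → (u ∈ X ++ x ∷ Y) ⇔ ((u ∈ X ++ x ∷ []) ⊎ (u ∈ x ∷ Y))
∈-joined X {x} {Y} = to , [ from , ∈-++⁺ʳ X ]′
  where
    to : ∀ {u} → u ∈ X ++ x ∷ Y → (u ∈ X ++ x ∷ []) ⊎ (u ∈ x ∷ Y)
    to i with ∈-++⁻ X i
    ... | inj₁ j = inj₁ (∈-++⁺ˡ j)
    ... | inj₂ j = inj₂ j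
    from : ∀ {u} → u ∈ X ++ x ∷ [] → u ∈ X ++ x ∷ Y
    from i with ∈-++⁻ X i
    ... | inj₁ j = ∈-++⁺ˡ j
    ... | inj₂ (here e) = ∈-++⁺ʳ X (here e)

consec-joined : ∀ X {x Y u w} → Consec (X ++ x ∷ Y) u w ⇔ (Consec (X ++ x ∷ []) u w ⊎ Consec (x ∷ Y) u w)
consec-joined X {x} {Y} = to , [ from , consec-++ʳ X ]′
  where
    to : ∀ {u w} → Consec (X ++ x ∷ Y) u w → Consec (X ++ x ∷ []) u w ⊎ Consec (x ∷ Y) u w
    to c with consec-++⁻ X c
    ... | inj₁ d = inj₁ (consec-++ˡ (x ∷ []) d)
    ... | inj₂ (inj₁ d) = inj₂ d
    ... | inj₂ (inj₂ (n , m)) = inj₁ (consec-seam X n m)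
    from : ∀ {u w} → Consec (X ++ x ∷ []) u w → Consec (X ++ x ∷ Y) u w
    from c with consec-++⁻ X c
    ... | inj₁ d = consec-++ˡ (x ∷ Y) d
    ... | inj₂ (inj₁ d) = ⊥-elim (consec-singleton d)
    ... | inj₂ (inj₂ (n , m)) = consec-seam X n m

data At : List ℕ → ℕ → ℕ → Set where
  at0 : ∀ {u L} → At (u ∷ L) 0 u
  atS : ∀ {a L i u} → At L i u → At (a ∷ L) (suc i) u

position : List ℕ → ℕ → ℕ
position [] u = 0
position (a ∷ L) u with a ≟ u
... | yes _ = 0
... | no _ = suc (position L u)

at-position : ∀ {L u} → u ∈ L → At L (position L u) u
at-position {a ∷ L} {u} i with a ≟ u
... | yes refl = at0
at-position {a ∷ L} {u} (here refl) | no a≢u = ⊥-elim (a≢u refl)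
at-position {a ∷ L} {u} (there i) | no _ = atS (at-position i)

at-∈ : ∀ {L i u} → At L i u → u ∈ L
at-∈ at0 = here refl
at-∈ (atS a) = there (at-∈ a)

position-at : ∀ {L i u} → Unique L → At L i u → position L u ≡ i
position-at {a ∷ L} {u = u} _ at0 with a ≟ u
... | yes _ = refl
... | no a≢u = ⊥-elim (a≢u refl)
position-at {a ∷ L} {u = u} (a∉ ∷ uL) (atS at) with a ≟ u
... | yes refl = ⊥-elim (All.lookup a∉ (at-∈ at) refl)
... | no _ = cong suc (position-at uL at)

at-< : ∀ {L i u} → At L i u → i < length L
at-< at0 = s≤s z≤n
at-< (atS a) = s≤s (at-< a)

<-at : ∀ {L i} → i < length L → ∃ λ u → At L i u
<-at {a ∷ L} {zero} _ = a , at0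
<-at {a ∷ L} {suc i} (s≤s i<) = let u , at = <-at i< in u , atS at

at-functional : ∀ {L i u w} → At L i u → At L i w → u ≡ w
at-functional at0 at0 = refl
at-functional (atS a) (atS b) = at-functional a b

at-++ˡ : ∀ {L i u} M → At L i u → At (L ++ M) i u
at-++ˡ M at0 = at0
at-++ˡ M (atS a) = atS (at-++ˡ M a)

at-++ʳ : ∀ L {M i u} → At M i u → At (L ++ M) (length L + i) u
at-++ʳ [] a = a
at-++ʳ (_ ∷ L) a = atS (at-++ʳ L a)

at-++⁻ : ∀ L {M i u} → At (L ++ M) i u → At L i u ⊎ (∃ λ j → (i ≡ length L + j) × At M j u)
at-++⁻ [] a = inj₂ (_ , refl , a)
at-++⁻ (_ ∷ L) at0 = inj₁ at0
at-++⁻ (_ ∷ L) (atS a) with at-++⁻ L a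
... | inj₁ b = inj₁ (atS b)
... | inj₂ (j , refl , b) = inj₂ (j , refl , b)

consec⇒at : ∀ {L u w} → Consec L u w → ∃ λ i → (At L i u × At L (suc i) w) ⊎ (At L i w × At L (suc i) u)
consec⇒at hereF = 0 , inj₁ (at0 , atS at0)
consec⇒at hereB = 0 , inj₂ (at0 , atS at0)
consec⇒at (there c) with consec⇒at c
... | i , inj₁ (a , b) = suc i , inj₁ (atS a , atS b)
... | i , inj₂ (a , b) = suc i , inj₂ (atS a , atS b)

at⇒consec : ∀ {L i u w} → At L i u → At L (suc i) w → Consec L u w
at⇒consec at0 (atS at0) = hereF
at⇒consec (atS a) (atS b) = there (at⇒consec a b)

-- A duplicate-free nonempty list C, read cyclically, is a cycle: consecutive
-- entries of C ++ [first C] are exactly the pairs whose positions in C are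
-- adjacent in C_(length C).
module CyclicList (C : List ℕ) (nonEmptyC : NonEmpty C) (uniqueC : Unique C) where
  n = length C
  closed = C ++ first C ∷ []

  at-first : At C 0 (first C)
  at-first = at-head nonEmptyC
    where at-head : ∀ {D} → NonEmpty D → At D 0 (first D)
          at-head nonEmpty = at0

  at-closing : At closed n (first C)
  at-closing = subst (λ k → At closed k (first C)) (+-identityʳ n) (at-++ʳ C at0)

  closed-length : length closed ≡ suc n
  closed-length = trans (length-++ C) (+-comm n 1)

  within : ∀ {i a} → At closed i a → i < n → At C i a
  within a i<n with at-++⁻ C a
  ... | inj₁ b = b
  ... | inj₂ (j , refl , _) = ⊥-elim (<⇒≱ i<n (m≤m+n n j))

  step⇒cycAdj : ∀ {i a b} → At closed i a → At closed (suc i) b → CycAdj₁ n (position C a) (position C b)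
  step⇒cycAdj {i} a b with within a (s<s⁻¹ (subst (suc i <_) closed-length (at-< b))) | at-++⁻ C b
  ... | a′ | inj₁ b′ = inj₁ (trans (cong suc (position-at uniqueC a′)) (sym (position-at uniqueC b′)))
  ... | a′ | inj₂ (j , eq , at0) =
    inj₂ (trans (cong suc (position-at uniqueC a′)) (trans eq (+-identityʳ n)) , position-at uniqueC at-first)

  cycAdj⇒consec : ∀ {a b} → a ∈ C → b ∈ C → CycAdj₁ n (position C a) (position C b) → Consec closed a b
  cycAdj⇒consec {a} {b} a∈ b∈ (inj₁ eq) =
    at⇒consec (at-++ˡ _ (at-position a∈)) (at-++ˡ _ (subst (λ k → At C k b) (sym eq) (at-position b∈)))
  cycAdj⇒consec {a} {b} a∈ b∈ (inj₂ (eq , eq₀)) with at-functional (subst (λ k → At C k b) eq₀ (at-position b∈)) at-first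
  ... | refl = at⇒consec (at-++ˡ _ (at-position a∈)) (subst (λ k → At closed k b) (sym eq) at-closing)

  cycAdj⇔consec : ∀ {u w} → u ∈ C → w ∈ C → CycAdj n (position C u) (position C w) ⇔ Consec closed u w
  cycAdj⇔consec u∈ w∈ = to , from
    where
      to : CycAdj n _ _ → Consec closed _ _
      to (inj₁ adj) = cycAdj⇒consec u∈ w∈ adj
      to (inj₂ adj) = consec-sym (cycAdj⇒consec w∈ u∈ adj)
      from : Consec closed _ _ → CycAdj n _ _
      from c with consec⇒at c
      ... | i , inj₁ (a , b) = inj₁ (step⇒cycAdj a b)
      ... | i , inj₂ (a , b) = inj₂ (step⇒cycAdj a b)

  cycle-iso : ∀ VH EH → (∀ {u} → u ∈ VH → u ∈ C) → (∀ {u} → u ∈ C → u ∈ VH) →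
    (∀ {u w} → u ∈ C → w ∈ C → Adj EH u w ⇔ Consec closed u w) → IsoToCycle VH EH n
  cycle-iso VH EH toC fromC links =
    position C ,
    (λ u u∈ → at-< (at-position (toC u∈))) ,
    (λ u w u∈ w∈ eq → at-functional (at-position (toC u∈)) (subst (λ k → At C k w) (sym eq) (at-position (toC w∈)))) ,
    (λ i i< → let u , at = <-at i< in u , fromC (at-∈ at) , position-at uniqueC at) ,
    (λ u w u∈ w∈ → let to , from = links (toC u∈) (toC w∈)
                       to′ , from′ = cycAdj⇔consec (toC u∈) (toC w∈)
                   in (λ a → from′ (to a)) , (λ c → from (to′ c)))

seams : List (List ℕ) → List (ℕ × ℕ)
seams (S ∷ S′ ∷ ss) = (final S , first S′) ∷ seams (S′ ∷ ss)
seams _ = []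

consec-concat⁻ : ∀ ss {u w} → All NonEmpty ss → Consec (concat ss) u w →
  Any (λ S → Consec S u w) ss ⊎ Adj (seams ss) u w
consec-concat⁻ (S ∷ []) _ c = inj₁ (here (subst (λ q → Consec q _ _) (++-identityʳ S) c))
consec-concat⁻ (S ∷ [] ∷ ss) (_ ∷ () ∷ _) c
consec-concat⁻ (S ∷ (y ∷ Y) ∷ ss) (_ ∷ ne) c with consec-++⁻ S c
... | inj₁ d = inj₁ (here d)
... | inj₂ (inj₂ (_ , m)) = inj₂ (Any⇒Adj (seams (S ∷ (y ∷ Y) ∷ ss)) (here m))
... | inj₂ (inj₁ d) with consec-concat⁻ ((y ∷ Y) ∷ ss) ne d
...   | inj₁ a = inj₁ (there a)
...   | inj₂ a = inj₂ (Any⇒Adj (seams (S ∷ (y ∷ Y) ∷ ss)) (there (Adj⇒Any _ a)))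

consec-concat⁺ : ∀ ss {u w} → All NonEmpty ss →
  Any (λ S → Consec S u w) ss ⊎ Adj (seams ss) u w → Consec (concat ss) u w
consec-concat⁺ (S ∷ ss) _ (inj₁ (here c)) = consec-++ˡ (concat ss) c
consec-concat⁺ (S ∷ S′ ∷ ss) (_ ∷ ne) (inj₁ (there a)) = consec-++ʳ S (consec-concat⁺ (S′ ∷ ss) ne (inj₁ a))
consec-concat⁺ (S ∷ []) _ (inj₂ ())
consec-concat⁺ (S ∷ [] ∷ ss) (_ ∷ () ∷ _) (inj₂ a)
consec-concat⁺ (S ∷ (y ∷ Y) ∷ ss) (n ∷ ne) (inj₂ a) with Adj⇒Any (seams (S ∷ (y ∷ Y) ∷ ss)) a
... | here m = consec-seam S n m
... | there a′ = consec-++ʳ S (consec-concat⁺ ((y ∷ Y) ∷ ss) ne (inj₂ (Any⇒Adj _ a′)))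

interleave : List (List ℕ) → List (List ℕ) → List (List ℕ)
interleave [] Y = Y
interleave (S ∷ X) Y = S ∷ interleave Y X

interleave-↭ : ∀ X Y → interleave X Y ↭ X ++ Y
interleave-↭ [] Y = ↭-refl
interleave-↭ (S ∷ X) Y = ↭-prep S (↭-trans (interleave-↭ Y X) (++-comm Y X))

module Alternation (Side : Bool → ℕ → Set) where

  Cross : ℕ × ℕ → Set
  Cross (u , w) = Σ Bool λ t → Side t u × Side (not t) w

  EndsOn : Bool → List ℕ → Set
  EndsOn t S = Side t (first S) × Side t (final S)

  -- Interleaving X (side t) with Y (side not t) and then returning to a vertex
  -- h alternates sides when the counts balance: |X| = |Y| and h on side t, or
  -- |X| = |Y| + 1 and h on side not t.
  data Balanced (X Y : List (List ℕ)) (t : Bool) (h : ℕ) : Set where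
    even : length X ≡ length Y → Side t h → Balanced X Y t h
    odd  : length X ≡ suc (length Y) → Side (not t) h → Balanced X Y t h

  side-not-not : ∀ t {u} → Side t u → Side (not (not t)) u
  side-not-not t = subst (λ s → Side s _) (sym (not-involutive t))

  balanced-swap : ∀ {S X Y t h} → Balanced (S ∷ X) Y t h → Balanced Y X (not t) h
  balanced-swap {t = t} (even eq h) = odd (sym eq) (side-not-not t h)
  balanced-swap (odd eq h) = even (sym (suc-injective eq)) h

  alternating-seams : ∀ t S X Y F → Side (not t) (final S) → All (EndsOn t) X → All (EndsOn (not t)) Y →
    Balanced X Y t (first F) → All Cross (seams (S ∷ interleave X Y ++ F ∷ []))
  alternating-seams t S [] [] F s _ _ (even _ h) = (not t , s , side-not-not t h) ∷ []
  alternating-seams t S [] [] F s _ _ (odd () _)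
  alternating-seams t S [] (_ ∷ _) F s _ _ (even () _)
  alternating-seams t S [] (_ ∷ _) F s _ _ (odd () _)
  alternating-seams t S (T ∷ X) Y F s ((h , f) ∷ onX) onY bal =
    (not t , s , side-not-not t h) ∷
    alternating-seams (not t) T Y X F (side-not-not t f) onY
      (All.map (λ (h′ , f′) → side-not-not t h′ , side-not-not t f′) onX) (balanced-swap bal)

Oriented : Graph → Graph → ℕ → ℕ × ℕ → Set
Oriented L₁ L₂ x (a , b) = (a ∈ V L₁) × (a ≢ x) × (b ∈ V L₂) × (b ≢ x)

HamiltonianClosure : Graph → Graph → ℕ → ℕ → Set
HamiltonianClosure L₁ L₂ x n = Σ (List (ℕ × ℕ)) λ E′ →
  (∀ a b → (a , b) ∈ E′ → Oriented L₁ L₂ x (a , b)) × IsoToCycle (V L₁ ++ V L₂) (E′ ++ (E L₁ ++ E L₂)) n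

module Construction (L₁ L₂ : Graph) (x : ℕ)
    (common : ∀ v → ((v ∈ V L₁) × (v ∈ V L₂)) ⇔ (v ≡ x))
    (R₁ : RootedCover L₁ x) (R₂ : RootedCover L₂ x) where

  forest : Bool → Graph
  forest true = L₁
  forest false = L₂

  rooted : ∀ t → RootedCover (forest t) x
  rooted true = R₁
  rooted false = R₂

  root : Bool → List ℕ
  root t = RootedCover.before (rooted t) ++ x ∷ RootedCover.after (rooted t)

  others : Bool → List (List ℕ)
  others t = RootedCover.others (rooted t)

  coverOf : ∀ t → PathCover (V (forest t)) (E (forest t)) (root t ∷ others t)
  coverOf t = RootedCover.cover (rooted t)

  x∈root : ∀ t → x ∈ root t
  x∈root t = ∈-++⁺ʳ (RootedCover.before (rooted t)) (here refl)

  root-inside : ∀ t {u} → u ∈ root t → u ∈ V (forest t)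
  root-inside t = PathCover.inside (coverOf t) (here refl)

  Side : Bool → ℕ → Set
  Side t u = (u ∈ V (forest t)) × (u ≢ x)

  open Alternation Side

  sides-exclusive : ∀ t {u} → Side t u → Side (not t) u → ⊥
  sides-exclusive true (u∈₁ , u≢x) (u∈₂ , _) = u≢x (proj₁ (common _) (u∈₁ , u∈₂))
  sides-exclusive false (u∈₂ , u≢x) (u∈₁ , _) = u≢x (proj₁ (common _) (u∈₁ , u∈₂))

  others-side : ∀ t {S u} → S ∈ others t → u ∈ S → Side t u
  others-side t S∈ u∈ = PathCover.inside (coverOf t) (there S∈) u∈
    , λ { refl → All.lookup (AllPairs.head (PathCover.disjointPaths (coverOf t))) S∈ (x∈root t , u∈) }

  others-ends : ∀ t → All (EndsOn t) (others t)
  others-ends t = All.tabulate λ S∈ →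
    let n = All.lookup (PathCover.nonEmptyPaths (coverOf t)) (there S∈)
    in others-side t S∈ (first∈ n) , others-side t S∈ (final∈ n)

  root-avoids-others : ∀ t t′ {u S} → u ∈ root t → S ∈ others t′ → u ∈ S → ⊥
  root-avoids-others true true u∈ S∈ u∈S = All.lookup (AllPairs.head (PathCover.disjointPaths (coverOf true))) S∈ (u∈ , u∈S)
  root-avoids-others false false u∈ S∈ u∈S = All.lookup (AllPairs.head (PathCover.disjointPaths (coverOf false))) S∈ (u∈ , u∈S)
  root-avoids-others true false u∈ S∈ u∈S = let s = others-side false S∈ u∈S in
    sides-exclusive false s (root-inside true u∈ , proj₂ s)
  root-avoids-others false true u∈ S∈ u∈S = let s = others-side true S∈ u∈S in
    sides-exclusive true s (root-inside false u∈ , proj₂ s)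

  record Spine : Set where
    field
      t         : Bool
      m         : ℕ
      M′        : List ℕ
      uniqueM   : Unique (m ∷ M′)
      vertices  : ∀ {u} → (u ∈ m ∷ M′) ⇔ (u ∈ root true ⊎ u ∈ root false)
      links     : ∀ {u w} → Consec (m ∷ M′) u w ⇔ (Consec (root true) u w ⊎ Consec (root false) u w)
      finalSide : Side (not t) (final (m ∷ M′))
      balanced  : Balanced (others t) (others (not t)) t m

  orient : ℕ × ℕ → ℕ × ℕ
  orient (a , b) with a ∈? V L₁
  ... | yes _ = a , b
  ... | no _ = b , a

  orient-cross : ∀ e → Cross e → Oriented L₁ L₂ x (orient e)
  orient-cross (a , b) cross with a ∈? V L₁
  orient-cross (a , b) (true , (a∈₁ , a≢x) , (b∈₂ , b≢x)) | yes _ = a∈₁ , a≢x , b∈₂ , b≢x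
  orient-cross (a , b) (false , a₂ , b₁) | yes a∈₁ = ⊥-elim (sides-exclusive true (a∈₁ , proj₂ a₂) a₂)
  orient-cross (a , b) (true , a₁ , b₂) | no a∉₁ = ⊥-elim (a∉₁ (proj₁ a₁))
  orient-cross (a , b) (false , (a∈₂ , a≢x) , (b∈₁ , b≢x)) | no _ = b∈₁ , b≢x , a∈₂ , a≢x

  match-orient : ∀ e {u w} → Match (orient e) u w ⇔ Match e u w
  match-orient (a , b) with a ∈? V L₁
  ... | yes _ = (λ m → m) , (λ m → m)
  ... | no _ = swap , swap
    where swap : ∀ {c d u w} → Match (c , d) u w → Match (d , c) u w
          swap (inj₁ (p , q)) = inj₂ (q , p)
          swap (inj₂ (p , q)) = inj₁ (q , p)

  adj-orient : ∀ J {u w} → Adj (map orient J) u w ⇔ Adj J u w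
  adj-orient J = (λ a → Any⇒Adj J (Any.map (λ {e} → proj₁ (match-orient e)) (Anyₚ.map⁻ (Adj⇒Any (map orient J) a))))
               , (λ a → Any⇒Adj (map orient J) (Anyₚ.map⁺ (Any.map (λ {e} → proj₂ (match-orient e)) (Adj⇒Any J a))))

  by-forest : ∀ {F : Bool → Set} t → (F t ⊎ F (not t)) ⇔ (F true ⊎ F false)
  by-forest true = (λ a → a) , (λ a → a)
  by-forest false = Data.Sum.swap , Data.Sum.swap

  BothSides : (List ℕ → Set) → Set
  BothSides R = Any R (root true ∷ others true) ⊎ Any R (root false ∷ others false)

  -- Closing a spine into a Hamiltonian cycle of L₁ ∪ L₂: after the spine,
  -- walk the other paths alternately from the two sides and return to m.
  module Closing (spine : Spine) where
    open Spine spine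

    M : List ℕ
    M = m ∷ M′

    Z : List (List ℕ)
    Z = interleave (others t) (others (not t))

    C : List ℕ
    C = concat (M ∷ Z)

    loop : List (List ℕ)
    loop = M ∷ Z ++ (m ∷ []) ∷ []

    E′ : List (ℕ × ℕ)
    E′ = map orient (seams loop)

    segments : ∀ {R} → R M ⇔ (R (root true) ⊎ R (root false)) → Any R (M ∷ Z) ⇔ BothSides R
    segments {R} onM = to , from
      where
        to : Any R (M ∷ Z) → BothSides R
        to (here r) = [ inj₁ ∘ here , inj₂ ∘ here ]′ (proj₁ onM r)
        to (there a) = [ inj₁ ∘ there , inj₂ ∘ there ]′
          (proj₁ (by-forest {λ s → Any R (others s)} t) (Anyₚ.++⁻ (others t) (Any-resp-↭ (interleave-↭ (others t) _) a)))
        fromOthers : Any R (others true) ⊎ Any R (others false) → Any R Z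
        fromOthers a = Any-resp-↭ (↭-sym (interleave-↭ (others t) _))
          ([ Anyₚ.++⁺ˡ , Anyₚ.++⁺ʳ (others t) ]′ (proj₂ (by-forest {λ s → Any R (others s)} t) a))
        from : BothSides R → Any R (M ∷ Z)
        from (inj₁ (here r)) = here (proj₂ onM (inj₁ r))
        from (inj₂ (here r)) = here (proj₂ onM (inj₂ r))
        from (inj₁ (there a)) = there (fromOthers (inj₁ a))
        from (inj₂ (there a)) = there (fromOthers (inj₂ a))

    cycle-vertices : ∀ {u} → (u ∈ C) ⇔ (u ∈ V L₁ ++ V L₂)
    cycle-vertices = ⇔-trans ((Anyₚ.concat⁻ (M ∷ Z)) , Anyₚ.concat⁺)
                    (⇔-trans (segments vertices)
                    (⇔-trans (⊎-⇔ (⇔-sym (cover-vertices (coverOf true))) (⇔-sym (cover-vertices (coverOf false))))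
                             ([ ∈-++⁺ˡ , ∈-++⁺ʳ (V L₁) ]′ , ∈-++⁻ (V L₁))))

    nonEmpty-loop : All NonEmpty loop
    nonEmpty-loop = Allₚ.++⁺ (nonEmpty ∷ All-resp-↭ (↭-sym (interleave-↭ (others t) _))
                               (Allₚ.++⁺ (All.tail (PathCover.nonEmptyPaths (coverOf t)))
                                         (All.tail (PathCover.nonEmptyPaths (coverOf (not t))))))
                             (nonEmpty ∷ [])

    loop-concat : concat loop ≡ C ++ m ∷ []
    loop-concat = sym (concat-++ (M ∷ Z) ((m ∷ []) ∷ []))

    spine-avoids : ∀ t′ {S} → S ∈ others t′ → Disjoint M S
    spine-avoids t′ S∈ (u∈M , u∈S) =
      [ (λ r → root-avoids-others true t′ r S∈ u∈S) , (λ r → root-avoids-others false t′ r S∈ u∈S) ]′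
        (proj₁ vertices u∈M)

    uniqueC : Unique C
    uniqueC = concat⁺ (uniqueM ∷ All-resp-↭ (↭-sym (interleave-↭ (others t) _))
                                   (Allₚ.++⁺ (All.tail (PathCover.uniquePaths (coverOf t)))
                                             (All.tail (PathCover.uniquePaths (coverOf (not t))))))
                      (All-resp-↭ (↭-sym (interleave-↭ (others t) _))
                         (Allₚ.++⁺ (All.tabulate (spine-avoids t)) (All.tabulate (spine-avoids (not t))))
                       ∷ disjoint-resp-↭ (↭-sym (interleave-↭ (others t) _))
                           (AllPairsₚ.++⁺ (AllPairs.tail (PathCover.disjointPaths (coverOf t)))
                                          (AllPairs.tail (PathCover.disjointPaths (coverOf (not t))))
                                          (All.tabulate λ S∈ → All.tabulate λ T∈ (u∈S , u∈T) →
                                             sides-exclusive t (others-side t S∈ u∈S) (others-side (not t) T∈ u∈T))))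

    -- the closing segment [m] has no links
    loop-links : ∀ {u w} → Any (λ S → Consec S u w) loop ⇔ Any (λ S → Consec S u w) (M ∷ Z)
    loop-links = (λ a → [ (λ b → b) , (λ { (here c) → ⊥-elim (consec-singleton c) }) ]′ (Anyₚ.++⁻ (M ∷ Z) a))
               , Anyₚ.++⁺ˡ

    -- The edges of the new graph join exactly the cyclically consecutive vertices
    -- of C: an edge is a seam or an edge of L₁ or L₂; the latter are the links of
    -- the paths of the two covers, i.e. the links of the segments M, Z₁, Z₂, …;
    -- links and seams of the loop are the consecutive pairs of C ++ [m].
    cycle-links : ∀ {u w} → Adj (E′ ++ (E L₁ ++ E L₂)) u w ⇔ Consec (C ++ m ∷ []) u w
    cycle-links =
      ⇔-trans (adj-++⇔ E′ _)
      (⇔-trans (⊎-⇔ (adj-orient (seams loop))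
                    (⇔-trans (adj-++⇔ (E L₁) (E L₂))
                             (⊎-⇔ (cover-edges (coverOf true) (λ a → proj₁ (adj-vertices L₁ a)))
                                  (cover-edges (coverOf false) (λ a → proj₁ (adj-vertices L₂ a))))))
      (⇔-trans (⊎-⇔ ((λ a → a) , (λ a → a)) (⇔-trans (⇔-sym (segments links)) (⇔-sym loop-links)))
      (⇔-trans (Data.Sum.swap , Data.Sum.swap)
      (⇔-trans (consec-concat⁺ loop nonEmpty-loop , consec-concat⁻ loop nonEmpty-loop)
               (consec-≡ loop-concat)))))

    crossings : All Cross (seams loop)
    crossings = alternating-seams t M (others t) (others (not t)) (m ∷ []) finalSide
                  (others-ends t) (others-ends (not t)) balanced

    oriented : ∀ a b → (a , b) ∈ E′ → Oriented L₁ L₂ x (a , b)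
    oriented a b i = let e , e∈ , eq = ∈-map⁻ orient i in
      subst (Oriented L₁ L₂ x) (sym eq) (orient-cross e (All.lookup crossings e∈))

    length-C : length C ≡ unionSize (V L₁) (V L₂)
    length-C = unique-length uniqueC (deduplicate-! _)
      (λ i → ∈-deduplicate⁺ _≟_ (proj₁ cycle-vertices i))
      (λ i → proj₂ cycle-vertices (∈-deduplicate⁻ _≟_ _ i))

    closing : HamiltonianClosure L₁ L₂ x (unionSize (V L₁) (V L₂))
    closing = E′ , oriented , subst (IsoToCycle (V L₁ ++ V L₂) (E′ ++ (E L₁ ++ E L₂))) length-C
      (CyclicList.cycle-iso C nonEmpty uniqueC (V L₁ ++ V L₂) (E′ ++ (E L₁ ++ E L₂))
         (proj₂ cycle-vertices) (proj₁ cycle-vertices) (λ _ _ → cycle-links))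

  -- x alone on the path of forest t and interior on the other one: the spine is
  -- the other path, and forest t has one more remaining path
  spine-alone : ∀ t → Placement x (root t) 0 → Placement x (root (not t)) 2 →
    length (others t) ≡ suc (length (others (not t))) → Spine
  spine-alone t (alone sX) (interior a A B nB sM) count = record
    { t = t ; m = a ; M′ = A ++ x ∷ B
    ; uniqueM = uniqueL
    ; vertices = ⇔-trans members (⇔-trans (inj₂ , [ x-on-other , (λ i → i) ]′) (by-forest {λ s → _ ∈ root s} t))
    ; links = ⇔-trans links (⇔-trans (inj₂ , [ no-links , (λ c → c) ]′) (by-forest {λ s → Consec (root s) _ _} t))
    ; finalSide = subst (Side (not t)) (sym (final-inner (a ∷ A) nB))
        (on-side (∈-++⁺ʳ (a ∷ A) (there (final∈ nB))) (λ { refl → x∉B (final∈ nB) }))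
    ; balanced = odd count (on-side (here refl) (λ { refl → x∉A (here refl) }))
    }
    where
      open SamePath sM
      open Sides (sides (a ∷ A) uniqueL)
      x-on-other : ∀ {u} → u ∈ root t → u ∈ root (not t)
      x-on-other i with proj₂ (SamePath.members sX) i
      ... | here refl = x∈root (not t)
      no-links : ∀ {u w} → Consec (root t) u w → Consec (root (not t)) u w
      no-links c = ⊥-elim (consec-singleton (proj₂ (SamePath.links sX) c))
      on-side : ∀ {u} → u ∈ (a ∷ A) ++ x ∷ B → u ≢ x → Side (not t) u
      on-side i u≢x = root-inside (not t) (proj₁ members i) , u≢x

  -- x at an end of both paths: the spine runs along the path of L₁ into x and
  -- on along the path of L₂; both forests have equally many remaining paths
  spine-endpoints : Placement x (root true) 1 → Placement x (root false) 1 →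
    length (others true) ≡ length (others false) → Spine
  spine-endpoints (endpoint (a ∷ X) nonEmpty sP) (endpoint (b ∷ Y) nonEmpty sQ′) count = record
    { t = true ; m = a ; M′ = X ++ x ∷ Y′
    ; uniqueM = ++⁺ uniqueA (SamePath.uniqueL sQ) disjoint
    ; vertices = ⇔-trans (∈-joined (a ∷ X)) (⊎-⇔ (SamePath.members sP) (SamePath.members sQ))
    ; links = ⇔-trans (consec-joined (a ∷ X)) (⊎-⇔ (SamePath.links sP) (SamePath.links sQ))
    ; finalSide = subst (Side false) (sym (final-inner (a ∷ X) (reverse-nonEmpty b Y)))
        (on-side false sQ (there (final∈ (reverse-nonEmpty b Y))) (λ { refl → x∉Y′ (final∈ (reverse-nonEmpty b Y)) }))
    ; balanced = even count (on-side true sP (here refl) (λ { refl → x∉A (here refl) }))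
    }
    where
      Y′ = reverse (b ∷ Y)
      sQ : SamePath (root false) (x ∷ Y′)
      sQ = samePath-≡ (reverse-++ (b ∷ Y) (x ∷ [])) (samePath-reverse sQ′)
      open Sides (sides (a ∷ X) (SamePath.uniqueL sP)) using (uniqueA; x∉A)
      x∉Y′ : x ∉ Y′
      x∉Y′ i = All.lookup (AllPairs.head (SamePath.uniqueL sQ)) i refl
      on-side : ∀ t {L u} → SamePath (root t) L → u ∈ L → u ≢ x → Side t u
      on-side t s i u≢x = root-inside t (proj₁ (SamePath.members s) i) , u≢x
      disjoint : Disjoint (a ∷ X) (x ∷ Y′)
      disjoint (i , here refl) = x∉A i
      disjoint (i , there j)
        with proj₁ (common _) ( root-inside true (proj₁ (SamePath.members sP) (∈-++⁺ˡ i))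
                              , root-inside false (proj₁ (SamePath.members sQ) (there j)))
      ... | refl = x∉A i

  -- the degree and component conditions leave three ways to place x
  spine : ∀ {d₁ d₂} → Placement x (root true) d₁ → Placement x (root false) d₂ → d₁ + d₂ ≡ 2 →
    suc (length (others true)) ≡ d₂ + length (others false) → Spine
  spine p₁@(interior _ _ _ _ _) p₂@(alone _) refl count = spine-alone false p₂ p₁ (sym count)
  spine p₁@(alone _) p₂@(interior _ _ _ _ _) refl count = spine-alone true p₁ p₂ (suc-injective count)
  spine p₁@(endpoint _ _ _) p₂@(endpoint _ _ _) refl count = spine-endpoints p₁ p₂ (suc-injective count)
  spine (alone _) (alone _) () _
  spine (alone _) (endpoint _ _ _) () _
  spine (endpoint _ _ _) (alone _) () _
  spine (endpoint _ _ _) (interior _ _ _ _ _) () _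
  spine (interior _ _ _ _ _) (endpoint _ _ _) () _
  spine (interior _ _ _ _ _) (interior _ _ _ _ _) () _

-- The theorem.
proposition7p2 : (k c : ℕ) → 6 ≤ k → 1 ≤ c → (L₁ L₂ : Graph) → (x : ℕ) →
  IsLinearForest L₁ → IsLinearForest L₂ →
  (∀ v → ((v ∈ V L₁) × (v ∈ V L₂)) ⇔ (v ≡ x)) →
  1 < length (V L₁) → 1 < length (V L₂) →
  degree L₁ x + degree L₂ x ≡ 2 →
  HasComponents (V L₁) (E L₁) c →
  HasComponents (V-del L₂ x) (E-del L₂ x) c →
  unionSize (V L₁) (V L₂) ≡ 2 * k →
  Σ (List (ℕ × ℕ)) λ E′ →
    (∀ a b → (a , b) ∈ E′ → (a ∈ V L₁) × (a ≢ x) × (b ∈ V L₂) × (b ≢ x)) ×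
    IsoToCycle (V L₁ ++ V L₂) (E′ ++ (E L₁ ++ E L₂)) (2 * k)
proposition7p2 k c _ _ L₁ L₂ x forest₁ forest₂ common _ _ degrees components₁ components₂ size =
  subst (HamiltonianClosure L₁ L₂ x) size
    (Closing.closing (spine (placement A₁ x B₁ unique₁) (placement A₂ x B₂ unique₂) placements counts))
  where
    x∈ = proj₂ (common x) refl
    R₁ = rootedCover L₁ forest₁ (proj₁ x∈)
    R₂ = rootedCover L₂ forest₂ (proj₂ x∈)
    open RootedCover R₁ using () renaming (before to A₁; after to B₁; others to ps; cover to cover₁)
    open RootedCover R₂ using () renaming (before to A₂; after to B₂; others to qs; cover to cover₂)
    open Construction L₁ L₂ x common R₁ R₂
    unique₁ = All.head (PathCover.uniquePaths cover₁)
    unique₂ = All.head (PathCover.uniquePaths cover₂)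

    placements : (length (piece A₁) + length (piece B₁)) + (length (piece A₂) + length (piece B₂)) ≡ 2
    placements = trans (sym (cong₂ _+_ (degree-root R₁) (degree-root R₂))) degrees

    counts : suc (length ps) ≡ (length (piece A₂) + length (piece B₂)) + length qs
    counts = trans (pathCover-count cover₁ components₁)
                   (sym (trans (sym (deletedPaths-length R₂)) (pathCover-count (deletion-cover R₂) components₂)))
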